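{- Let $k\ge 1$ be an integer and let $\vec G=(V,\vec E)$ be a directed graph whose underlying undirected graph $G=(V,E)$ has an $f$-weighted $\beta$-orientation for every mapping $f:E\to\mathbb{Z}_{2k+1}\setminus\{0\}$ and every $\mathbb{Z}_{2k+1}$-boundary $\beta$. For every arc $\vec e\in\vec E$, let $L(\vec e)$ be a pair of distinct elements of $\mathbb{Z}_{2k+1}$. Then for every $\mathbb{Z}_{2k+1}$-boundary $\beta$, $\vec G$ has a $\mathbb{Z}_{2k+1}$-flow $g$ with boundary $\beta$ such that $g(\vec e)\in L(\vec e)$ for every $\vec e\in\vec E$.
   Context: Graphs may have multiple edges but no loops. A $\mathbb{Z}_{m}$-boundary of a graph with vertex set $V$ is a map $\beta:V\to\mathbb{Z}_{m}$ with $\sum_{v\in V}\beta(v)\equiv 0\pmod m$. For an orientation (or directed graph) and a weight map $f$ on its edges/arcs with values in $\mathbb{Z}_m$, set $\partial f(v)=\sum_{\text{arcs } e \text{ leaving } v}f(e)-\sum_{\text{arcs }e\text{ entering }v}f(e)$. Given $f:E\to\mathbb{Z}_m$, an orientation of $G$ is an $f$-weighted $\beta$-orientation if $\partial f(v)\equiv\beta(v)\pmod m$ for all $v$. A $\mathbb{Z}_m$-flow with boundary $\beta$ in $\vec G$ is a map $g:\vec E\to\mathbb{Z}_m$ with $\partial g(v)\equiv\beta(v)\pmod m$ for all $v$. -}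

module Defs where

open import Data.Nat using (ℕ; zero; suc; _+_; _*_)
open import Data.Fin using (Fin; toℕ; zero; suc)
open import Data.Fin.Properties using (_≟_)
open import Data.Bool using (Bool; true; false; if_then_else_)
open import Data.Integer as ℤ using (ℤ; +_; -_) renaming (_+_ to _+ℤ_; _-_ to _-ℤ_)
open import Data.Integer.Divisibility using () renaming (_∣_ to _∣ℤ_)
open import Relation.Nullary using (¬_; does)
open import Relation.Binary.PropositionalEquality using (_≡_)
open import Data.Product using (_×_)
open import Data.Sum using (_⊎_)

-- Its underlying undirected
-- graph has the same vertex set and edge set Fin m (edge e joins tail e, head e).
record Digraph : Set where
  field
    n    : ℕ
    m    : ℕ
    tail : Fin m → Fin n
    head : Fin m → Fin n
    loopless : ∀ e → ¬ (tail e ≡ head e)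
open Digraph public

-- Z_N is represented by Fin N (residues 0..N-1).

_≡[mod_]_ : ℤ → ℕ → ℤ → Set
a ≡[mod N ] b = (+ N) ∣ℤ (a -ℤ b)

Σ : (m : ℕ) → (Fin m → ℤ) → ℤ
Σ zero    h = + 0
Σ (suc m) h = h zero +ℤ Σ m (λ i → h (suc i))

∂ : {n m N : ℕ} → (Fin m → Fin n) → (Fin m → Fin n) → (Fin m → Fin N) → Fin n → ℤ
∂ {m = m} t h f v =
  Σ m (λ e → (if does (t e ≟ v) then + toℕ (f e) else + 0)
            -ℤ (if does (h e ≟ v) then + toℕ (f e) else + 0))

IsBoundary : (G : Digraph) (N : ℕ) → (Fin (n G) → Fin N) → Set
IsBoundary G N β = Σ (n G) (λ v → + toℕ (β v)) ≡[mod N ] (+ 0)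

-- An orientation of the underlying undirected graph: for each edge, a Bool
-- saying whether it is oriented as tail→head (true) or head→tail (false).
Orientation : Digraph → Set
Orientation G = Fin (m G) → Bool

otail : (G : Digraph) → Orientation G → Fin (m G) → Fin (n G)
otail G o e = if o e then tail G e else head G e

ohead : (G : Digraph) → Orientation G → Fin (m G) → Fin (n G)
ohead G o e = if o e then head G e else tail G e

IsWeightedOrientation : (G : Digraph) (N : ℕ) → (Fin (m G) → Fin N)
  → (Fin (n G) → Fin N) → Orientation G → Set
IsWeightedOrientation G N f β o =
  ∀ v → ∂ (otail G o) (ohead G o) f v ≡[mod N ] (+ toℕ (β v))

IsFlow : (G : Digraph) (N : ℕ) → (Fin (m G) → Fin N) → (Fin (n G) → Fin N) → Set
IsFlow G N g β = ∀ v → ∂ (tail G) (head G) g v ≡[mod N ] (+ toℕ (β v))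

module Submission where

-- Since 2 is invertible modulo 2k + 1, every list {a, b} can be written as {c − d, c + d}
-- with c = (a + b)/2 and d = (b − a)/2 ≠ 0. Take a d-weighted (β − ∂c)-orientation o of G
-- and put c + d on the arcs that o keeps and c − d on the arcs that o reverses: on every
-- arc this is c plus ±d, so its boundary is ∂c + (β − ∂c) = β.

open import Defs
open import Data.Nat using (ℕ; suc; _*_; _≥_)
open import Data.Fin using (Fin; zero)
open import Data.Product using (Σ-syntax; _×_)
open import Data.Sum using (_⊎_)
open import Relation.Nullary using (¬_)
open import Relation.Binary.PropositionalEquality using (_≡_)

open import Data.Bool using (Bool; true; false; if_then_else_)
open import Data.Fin using (suc; toℕ; fromℕ<)
open import Data.Fin.Properties using (_≟_; toℕ<n; toℕ-fromℕ<; toℕ-injective)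
open import Data.Integer as ℤ using (ℤ; +_; -_; 0ℤ; _+_; _-_; 1ℤ)
import Data.Integer.Properties as ℤ
open import Data.Integer.Divisibility.Signed using (_∣_; divides; ∣⇒∣ᵤ; ∣ᵤ⇒∣; ∣m∣n⇒∣m+n; ∣m⇒∣-m; ∣n⇒∣m*n)
open import Data.Integer.DivMod using (_%ℕ_; _/ℕ_; n%ℕd<d; a≡a%ℕn+[a/ℕn]*n)
open import Data.Integer.Tactic.RingSolver using (solve-∀)
import Data.Nat as ℕ
import Data.Nat.Properties as ℕ
import Data.Nat.Divisibility as ℕ
open import Data.Nat.DivMod using (_%_; m<n⇒m%n≡m; %-remove-+ˡ)
open import Data.Product using (_,_)
open import Data.Sum using (inj₁; inj₂)
open import Function using (_∘_)
open import Level using (0ℓ)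
open import Relation.Nullary using (does)
open import Relation.Binary.Bundles using (Setoid)
open import Relation.Binary.PropositionalEquality using (_≢_; refl; sym; trans; cong; cong₂; subst; module ≡-Reasoning)
import Relation.Binary.Reasoning.Setoid as SetoidReasoning

toℤ : ∀ {N} → Fin N → ℤ
toℤ x = + toℕ x

Σ-cong : ∀ m {f g : Fin m → ℤ} → (∀ i → f i ≡ g i) → Σ m f ≡ Σ m g
Σ-cong ℕ.zero    f≡g = refl
Σ-cong (ℕ.suc m) f≡g = cong₂ _+_ (f≡g zero) (Σ-cong m (λ i → f≡g (suc i)))

Σ-zero : ∀ m → Σ m (λ _ → 0ℤ) ≡ 0ℤ
Σ-zero ℕ.zero    = refl
Σ-zero (ℕ.suc m) = trans (ℤ.+-identityˡ (Σ m (λ _ → 0ℤ))) (Σ-zero m)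

Σ-distrib-+ : ∀ m (f g : Fin m → ℤ) → Σ m (λ i → f i + g i) ≡ Σ m f + Σ m g
Σ-distrib-+ ℕ.zero    f g = refl
Σ-distrib-+ (ℕ.suc m) f g = trans
  (cong (_+_ (f zero + g zero)) (Σ-distrib-+ m (λ i → f (suc i)) (λ i → g (suc i))))
  (interchange (f zero) (g zero) (Σ m (λ i → f (suc i))) (Σ m (λ i → g (suc i))))
  where
  interchange : ∀ a b c d → (a + b) + (c + d) ≡ (a + c) + (b + d)
  interchange = solve-∀

Σ-distrib-neg : ∀ m (f : Fin m → ℤ) → Σ m (λ i → - f i) ≡ - Σ m f
Σ-distrib-neg ℕ.zero    f = refl
Σ-distrib-neg (ℕ.suc m) f = trans
  (cong (_+_ (- f zero)) (Σ-distrib-neg m (λ i → f (suc i))))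
  (sym (ℤ.neg-distrib-+ (f zero) (Σ m (λ i → f (suc i)))))

Σ-distrib-- : ∀ m (f g : Fin m → ℤ) → Σ m (λ i → f i - g i) ≡ Σ m f - Σ m g
Σ-distrib-- m f g = trans (Σ-distrib-+ m f (λ i → - g i)) (cong (_+_ (Σ m f)) (Σ-distrib-neg m g))

Σ-comm : ∀ n m (f : Fin n → Fin m → ℤ) →
  Σ n (λ v → Σ m (f v)) ≡ Σ m (λ e → Σ n (λ v → f v e))
Σ-comm ℕ.zero    m f = sym (Σ-zero m)
Σ-comm (ℕ.suc n) m f = trans
  (cong (_+_ (Σ m (f zero))) (Σ-comm n m (λ v → f (suc v))))
  (sym (Σ-distrib-+ m (f zero) (λ e → Σ n (λ v → f (suc v) e))))

when : Bool → ℤ → ℤ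
when b x = if b then x else 0ℤ

Σ-when-≟ : ∀ n (u : Fin n) x → Σ n (λ v → when (does (u ≟ v)) x) ≡ x
Σ-when-≟ (ℕ.suc n) zero    x = trans (cong (_+_ x) (Σ-zero n)) (ℤ.+-identityʳ x)
Σ-when-≟ (ℕ.suc n) (suc u) x = trans (ℤ.+-identityˡ _) (Σ-when-≟ n u x)

when-+ : ∀ b x y → when b (x + y) ≡ when b x + when b y
when-+ true  x y = refl
when-+ false x y = refl

when-neg : ∀ b x → when b (- x) ≡ - when b x
when-neg true  x = refl
when-neg false x = refl

arcOutflow : ∀ {n} → Fin n → Fin n → ℤ → Fin n → ℤ
arcOutflow t h x v = when (does (t ≟ v)) x - when (does (h ≟ v)) x

arcOutflow-+ : ∀ {n} (t h : Fin n) x y v →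
  arcOutflow t h (x + y) v ≡ arcOutflow t h x v + arcOutflow t h y v
arcOutflow-+ t h x y v = trans
  (cong₂ _-_ (when-+ (does (t ≟ v)) x y) (when-+ (does (h ≟ v)) x y))
  (interchange (when (does (t ≟ v)) x) (when (does (t ≟ v)) y) (when (does (h ≟ v)) x) (when (does (h ≟ v)) y))
  where
  interchange : ∀ a b c d → (a + b) - (c + d) ≡ (a - c) + (b - d)
  interchange = solve-∀

arcOutflow-flip : ∀ {n} (t h : Fin n) x v → arcOutflow h t x v ≡ arcOutflow t h (- x) v
arcOutflow-flip t h x v = trans
  (swap (when (does (h ≟ v)) x) (when (does (t ≟ v)) x))
  (sym (cong₂ _-_ (when-neg (does (t ≟ v)) x) (when-neg (does (h ≟ v)) x)))
  where
  swap : ∀ a b → a - b ≡ (- b) - (- a)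
  swap = solve-∀

Σ-arcOutflow : ∀ n (t h : Fin n) x → Σ n (arcOutflow t h x) ≡ 0ℤ
Σ-arcOutflow n t h x = begin
  Σ n (arcOutflow t h x)
    ≡⟨ Σ-distrib-- n (λ v → when (does (t ≟ v)) x) (λ v → when (does (h ≟ v)) x) ⟩
  Σ n (λ v → when (does (t ≟ v)) x) - Σ n (λ v → when (does (h ≟ v)) x)
    ≡⟨ cong₂ _-_ (Σ-when-≟ n t x) (Σ-when-≟ n h x) ⟩
  x - x
    ≡⟨ ℤ.+-inverseʳ x ⟩
  0ℤ ∎
  where open ≡-Reasoning

outflow : ∀ {n m} → (Fin m → Fin n) → (Fin m → Fin n) → (Fin m → ℤ) → Fin n → ℤ
outflow {m = m} t h w v = Σ m (λ e → arcOutflow (t e) (h e) (w e) v)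

∂≡outflow : ∀ {n m N} (t h : Fin m → Fin n) (f : Fin m → Fin N) v →
  ∂ t h f v ≡ outflow t h (toℤ ∘ f) v
∂≡outflow t h f v = refl

outflow-+ : ∀ {n m} (t h : Fin m → Fin n) (w₁ w₂ : Fin m → ℤ) v →
  outflow t h (λ e → w₁ e + w₂ e) v ≡ outflow t h w₁ v + outflow t h w₂ v
outflow-+ {m = m} t h w₁ w₂ v = trans
  (Σ-cong m (λ e → arcOutflow-+ (t e) (h e) (w₁ e) (w₂ e) v))
  (Σ-distrib-+ m (λ e → arcOutflow (t e) (h e) (w₁ e) v) (λ e → arcOutflow (t e) (h e) (w₂ e) v))

Σ-outflow : ∀ {n m} (t h : Fin m → Fin n) (w : Fin m → ℤ) → Σ n (outflow t h w) ≡ 0ℤ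
Σ-outflow {n} {m} t h w = begin
  Σ n (outflow t h w)                             ≡⟨ Σ-comm n m (λ v e → arcOutflow (t e) (h e) (w e) v) ⟩
  Σ m (λ e → Σ n (arcOutflow (t e) (h e) (w e)))  ≡⟨ Σ-cong m (λ e → Σ-arcOutflow n (t e) (h e) (w e)) ⟩
  Σ m (λ _ → 0ℤ)                                  ≡⟨ Σ-zero m ⟩
  0ℤ                                              ∎
  where open ≡-Reasoning

signed : ∀ {m} → (Fin m → Bool) → (Fin m → ℤ) → Fin m → ℤ
signed o w e = if o e then w e else - w e

outflow-reorient : ∀ {n m} (o : Fin m → Bool) (t h : Fin m → Fin n) (w : Fin m → ℤ) v →
  outflow (λ e → if o e then t e else h e) (λ e → if o e then h e else t e) w v
    ≡ outflow t h (signed o w) v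
outflow-reorient {m = m} o t h w v = Σ-cong m arc
  where
  arc : ∀ e → arcOutflow (if o e then t e else h e) (if o e then h e else t e) (w e) v
            ≡ arcOutflow (t e) (h e) (signed o w e) v
  arc e with o e
  ... | true  = refl
  ... | false = arcOutflow-flip (t e) (h e) (w e) v

module Modular (N : ℕ) where

  -- A record rather than a definition, so that a and b can be inferred from a proof of a ≈ b.
  infix 4 _≈_
  record _≈_ (a b : ℤ) : Set where
    constructor ≈-intro
    field modulus∣difference : + N ∣ a - b

  ≈-by : ∀ {a b} x → x ≡ a - b → + N ∣ x → a ≈ b
  ≈-by x refl N∣x = ≈-intro N∣x

  ≈-refl : ∀ {a} → a ≈ a
  ≈-refl {a} = ≈-by 0ℤ (sym (ℤ.+-inverseʳ a)) (divides 0ℤ refl)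

  ≈-sym : ∀ {a b} → a ≈ b → b ≈ a
  ≈-sym {a} {b} (≈-intro p) = ≈-by _ (identity a b) (∣m⇒∣-m p)
    where
    identity : ∀ a b → - (a - b) ≡ b - a
    identity = solve-∀

  ≈-trans : ∀ {a b c} → a ≈ b → b ≈ c → a ≈ c
  ≈-trans {a} {b} {c} (≈-intro p) (≈-intro q) = ≈-by _ (identity a b c) (∣m∣n⇒∣m+n p q)
    where
    identity : ∀ a b c → (a - b) + (b - c) ≡ a - c
    identity = solve-∀

  +-cong : ∀ {a b c d} → a ≈ b → c ≈ d → a + c ≈ b + d
  +-cong {a} {b} {c} {d} (≈-intro p) (≈-intro q) = ≈-by _ (identity a b c d) (∣m∣n⇒∣m+n p q)
    where
    identity : ∀ a b c d → (a - b) + (c - d) ≡ (a + c) - (b + d)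
    identity = solve-∀

  +-congˡ : ∀ a {b c} → b ≈ c → a + b ≈ a + c
  +-congˡ a = +-cong (≈-refl {a})

  -‿cong : ∀ {a b} → a ≈ b → - a ≈ - b
  -‿cong {a} {b} (≈-intro p) = ≈-by _ (identity a b) (∣m⇒∣-m p)
    where
    identity : ∀ a b → - (a - b) ≡ (- a) - (- b)
    identity = solve-∀

  *-congˡ : ∀ k {a b} → a ≈ b → k ℤ.* a ≈ k ℤ.* b
  *-congˡ k {a} {b} (≈-intro p) = ≈-by _ (identity k a b) (∣n⇒∣m*n k p)
    where
    identity : ∀ k a b → k ℤ.* (a - b) ≡ k ℤ.* a - k ℤ.* b
    identity = solve-∀

  N≈0 : + N ≈ 0ℤ
  N≈0 = ≈-by _ (identity (+ N)) (divides 1ℤ refl)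
    where
    identity : ∀ n → 1ℤ ℤ.* n ≡ n - 0ℤ
    identity = solve-∀

  ≈-setoid : Setoid 0ℓ 0ℓ
  ≈-setoid = record
    { Carrier       = ℤ
    ; _≈_           = _≈_
    ; isEquivalence = record { refl = ≈-refl ; sym = ≈-sym ; trans = ≈-trans }
    }

  module ≈-Reasoning = SetoidReasoning ≈-setoid

  ≈⇒≡[mod] : ∀ {a b} → a ≈ b → a ≡[mod N ] b
  ≈⇒≡[mod] (≈-intro p) = ∣⇒∣ᵤ p

  ≡[mod]⇒≈ : ∀ {a b} → a ≡[mod N ] b → a ≈ b
  ≡[mod]⇒≈ p = ≈-intro (∣ᵤ⇒∣ p)

  Σ-cong≈ : ∀ m {f g : Fin m → ℤ} → (∀ i → f i ≈ g i) → Σ m f ≈ Σ m g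
  Σ-cong≈ ℕ.zero    f≈g = ≈-refl
  Σ-cong≈ (ℕ.suc m) f≈g = +-cong (f≈g zero) (Σ-cong≈ m (λ i → f≈g (suc i)))

  when-cong : ∀ b {x y} → x ≈ y → when b x ≈ when b y
  when-cong true  x≈y = x≈y
  when-cong false x≈y = ≈-refl

  outflow-cong : ∀ {n m} (t h : Fin m → Fin n) {w₁ w₂ : Fin m → ℤ} →
    (∀ e → w₁ e ≈ w₂ e) → ∀ v → outflow t h w₁ v ≈ outflow t h w₂ v
  outflow-cong {m = m} t h w₁≈w₂ v = Σ-cong≈ m (λ e →
    +-cong (when-cong (does (t e ≟ v)) (w₁≈w₂ e)) (-‿cong (when-cong (does (h e ≟ v)) (w₁≈w₂ e))))

∣n∸m⇒m≡n : ∀ {N x y} .{{_ : ℕ.NonZero N}} → x ℕ.≤ y → y ℕ.< N → N ℕ.∣ y ℕ.∸ x → x ≡ y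
∣n∸m⇒m≡n {N} {x} {y} x≤y y<N N∣y-x = begin
  x                     ≡⟨ sym (m<n⇒m%n≡m (ℕ.≤-<-trans x≤y y<N)) ⟩
  x % N                 ≡⟨ sym (%-remove-+ˡ x N∣y-x) ⟩
  (y ℕ.∸ x ℕ.+ x) % N   ≡⟨ cong (_% N) (ℕ.m∸n+n≡m x≤y) ⟩
  y % N                 ≡⟨ m<n⇒m%n≡m y<N ⟩
  y                     ∎
  where open ≡-Reasoning

module Residues (N : ℕ) .{{_ : ℕ.NonZero N}} where
  open Modular N
  open ≈-Reasoning

  reduce : ℤ → Fin N
  reduce x = fromℕ< (n%ℕd<d x N)

  toℤ-reduce : ∀ x → toℤ (reduce x) ≈ x
  toℤ-reduce x = ≈-sym (begin
    x                                ≡⟨ a≡a%ℕn+[a/ℕn]*n x N ⟩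
    + (x %ℕ N) + (x /ℕ N) ℤ.* + N    ≈⟨ +-congˡ (+ (x %ℕ N)) (*-congˡ (x /ℕ N) N≈0) ⟩
    + (x %ℕ N) + (x /ℕ N) ℤ.* 0ℤ     ≡⟨ identity (+ (x %ℕ N)) (x /ℕ N) ⟩
    + (x %ℕ N)                       ≡⟨ cong +_ (sym (toℕ-fromℕ< (n%ℕd<d x N))) ⟩
    toℤ (reduce x)                   ∎)
    where
    identity : ∀ r q → r + q ℤ.* 0ℤ ≡ r
    identity = solve-∀

  +m≈+n⇒m≡n : ∀ {x y} → x ℕ.≤ y → y ℕ.< N → + x ≈ + y → x ≡ y
  +m≈+n⇒m≡n {x} {y} x≤y y<N (≈-intro N∣x-y) =
    ∣n∸m⇒m≡n x≤y y<N (subst (N ℕ.∣_) ∣x-y∣≡y∸x (∣⇒∣ᵤ N∣x-y))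
    where
    ∣x-y∣≡y∸x : ℤ.∣ + x - + y ∣ ≡ y ℕ.∸ x
    ∣x-y∣≡y∸x = trans (cong ℤ.∣_∣ (ℤ.m-n≡m⊖n x y)) (ℤ.∣⊖∣-≤ x≤y)

  toℤ-injective : ∀ {x y : Fin N} → toℤ x ≈ toℤ y → x ≡ y
  toℤ-injective {x} {y} x≈y with ℕ.≤-total (toℕ x) (toℕ y)
  ... | inj₁ x≤y = toℕ-injective (+m≈+n⇒m≡n x≤y (toℕ<n y) x≈y)
  ... | inj₂ y≤x = sym (toℕ-injective (+m≈+n⇒m≡n y≤x (toℕ<n x) (≈-sym x≈y)))

module Halving (k : ℕ) where
  open Modular (suc (2 * k))
  open Residues (suc (2 * k))
  open ≈-Reasoning

  -- k + 1 is the inverse of 2 modulo 2k + 1.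
  half : ℤ → ℤ
  half x = x ℤ.* (1ℤ + + k)

  half+half≈ : ∀ x → half x + half x ≈ x
  half+half≈ x = begin
    half x + half x                    ≡⟨ doubling x (+ k) ⟩
    x + x ℤ.* (1ℤ + + 2 ℤ.* + k)       ≡⟨ cong (λ n → x + x ℤ.* (1ℤ + n)) (sym (ℤ.pos-* 2 k)) ⟩
    x + x ℤ.* + suc (2 * k)            ≈⟨ +-congˡ x (*-congˡ x N≈0) ⟩
    x + x ℤ.* 0ℤ                       ≡⟨ annihilate x ⟩
    x                                  ∎
    where
    doubling : ∀ x K → x ℤ.* (1ℤ + K) + x ℤ.* (1ℤ + K) ≡ x + x ℤ.* (1ℤ + + 2 ℤ.* K)
    doubling = solve-∀
    annihilate : ∀ x → x + x ℤ.* 0ℤ ≡ x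
    annihilate = solve-∀

  centre radius : Fin (suc (2 * k)) → Fin (suc (2 * k)) → Fin (suc (2 * k))
  centre x y = reduce (half (toℤ x + toℤ y))
  radius x y = reduce (half (toℤ y - toℤ x))

  centre+radius≈ : ∀ x y → toℤ (centre x y) + toℤ (radius x y) ≈ toℤ y
  centre+radius≈ x y = begin
    toℤ (centre x y) + toℤ (radius x y)
      ≈⟨ +-cong (toℤ-reduce (half (toℤ x + toℤ y))) (toℤ-reduce (half (toℤ y - toℤ x))) ⟩
    half (toℤ x + toℤ y) + half (toℤ y - toℤ x)
      ≡⟨ identity (toℤ x) (toℤ y) (1ℤ + + k) ⟩
    half (toℤ y) + half (toℤ y)
      ≈⟨ half+half≈ (toℤ y) ⟩
    toℤ y ∎
    where
    identity : ∀ a b u → (a + b) ℤ.* u + (b - a) ℤ.* u ≡ b ℤ.* u + b ℤ.* u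
    identity = solve-∀

  centre-radius≈ : ∀ x y → toℤ (centre x y) - toℤ (radius x y) ≈ toℤ x
  centre-radius≈ x y = begin
    toℤ (centre x y) - toℤ (radius x y)
      ≈⟨ +-cong (toℤ-reduce (half (toℤ x + toℤ y))) (-‿cong (toℤ-reduce (half (toℤ y - toℤ x)))) ⟩
    half (toℤ x + toℤ y) - half (toℤ y - toℤ x)
      ≡⟨ identity (toℤ x) (toℤ y) (1ℤ + + k) ⟩
    half (toℤ x) + half (toℤ x)
      ≈⟨ half+half≈ (toℤ x) ⟩
    toℤ x ∎
    where
    identity : ∀ a b u → (a + b) ℤ.* u - (b - a) ℤ.* u ≡ a ℤ.* u + a ℤ.* u
    identity = solve-∀

  radius≢0 : ∀ {x y} → x ≢ y → radius x y ≢ zero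
  radius≢0 {x} {y} x≢y r≡0 = x≢y (toℤ-injective (begin
    toℤ x                      ≈⟨ ≈-sym (centre-radius≈ x y) ⟩
    c - toℤ (radius x y)       ≡⟨ cong (λ r → c - toℤ r) r≡0 ⟩
    c + 0ℤ                     ≡⟨ cong (λ r → c + toℤ r) (sym r≡0) ⟩
    c + toℤ (radius x y)       ≈⟨ centre+radius≈ x y ⟩
    toℤ y                      ∎))
    where
    c : ℤ
    c = toℤ (centre x y)

module ListFlow (G : Digraph) (N : ℕ) .{{_ : ℕ.NonZero N}} where
  open Modular N
  open Residues N
  open ≈-Reasoning

  shiftBoundary : (Fin (n G) → Fin N) → (Fin (m G) → Fin N) → Fin (n G) → Fin N
  shiftBoundary β c v = reduce (toℤ (β v) - ∂ (tail G) (head G) c v)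

  shiftBoundary-isBoundary : ∀ {β} c → IsBoundary G N β → IsBoundary G N (shiftBoundary β c)
  shiftBoundary-isBoundary {β} c β-boundary = ≈⇒≡[mod] (begin
    Σ (n G) (toℤ ∘ shiftBoundary β c)  ≈⟨ Σ-cong≈ (n G) (λ v → toℤ-reduce (toℤ (β v) - ∂c v)) ⟩
    Σ (n G) (λ v → toℤ (β v) - ∂c v)   ≡⟨ Σ-distrib-- (n G) (toℤ ∘ β) ∂c ⟩
    Σ (n G) (toℤ ∘ β) - Σ (n G) ∂c     ≡⟨ cong (λ s → Σ (n G) (toℤ ∘ β) - s) (Σ-outflow (tail G) (head G) (toℤ ∘ c)) ⟩
    Σ (n G) (toℤ ∘ β) + 0ℤ             ≡⟨ ℤ.+-identityʳ (Σ (n G) (toℤ ∘ β)) ⟩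
    Σ (n G) (toℤ ∘ β)                  ≈⟨ ≡[mod]⇒≈ β-boundary ⟩
    0ℤ                                 ∎)
    where
    ∂c : Fin (n G) → ℤ
    ∂c = ∂ (tail G) (head G) c

  pick : Orientation G → (L₁ L₂ : Fin (m G) → Fin N) → Fin (m G) → Fin N
  pick o L₁ L₂ e = if o e then L₂ e else L₁ e

  pick-∈ : ∀ o L₁ L₂ e → (pick o L₁ L₂ e ≡ L₁ e) ⊎ (pick o L₁ L₂ e ≡ L₂ e)
  pick-∈ o L₁ L₂ e with o e
  ... | true  = inj₂ refl
  ... | false = inj₁ refl

  pick-isFlow : ∀ {β} (c d L₁ L₂ : Fin (m G) → Fin N) →
    (∀ e → toℤ (c e) - toℤ (d e) ≈ toℤ (L₁ e)) → (∀ e → toℤ (c e) + toℤ (d e) ≈ toℤ (L₂ e)) →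
    ∀ o → IsWeightedOrientation G N d (shiftBoundary β c) o → IsFlow G N (pick o L₁ L₂) β
  pick-isFlow {β} c d L₁ L₂ c-d≈L₁ c+d≈L₂ o o-orients v = ≈⇒≡[mod] (begin
    ∂ t h (pick o L₁ L₂) v                       ≡⟨ ∂≡outflow t h (pick o L₁ L₂) v ⟩
    outflow t h (toℤ ∘ pick o L₁ L₂) v           ≈⟨ outflow-cong t h (λ e → ≈-sym (pick≈ e)) v ⟩
    outflow t h (λ e → toℤ (c e) + ±d e) v       ≡⟨ outflow-+ t h (toℤ ∘ c) ±d v ⟩
    ∂c + outflow t h ±d v                        ≡⟨ cong (_+_ ∂c) (sym (outflow-reorient o t h (toℤ ∘ d) v)) ⟩
    ∂c + ∂ (otail G o) (ohead G o) d v           ≈⟨ +-congˡ ∂c (≡[mod]⇒≈ (o-orients v)) ⟩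
    ∂c + toℤ (shiftBoundary β c v)               ≈⟨ +-congˡ ∂c (toℤ-reduce (toℤ (β v) - ∂c)) ⟩
    ∂c + (toℤ (β v) - ∂c)                        ≡⟨ cancel ∂c (toℤ (β v)) ⟩
    toℤ (β v)                                    ∎)
    where
    t h : Fin (m G) → Fin (n G)
    t = tail G
    h = head G
    ∂c : ℤ
    ∂c = ∂ t h c v
    ±d : Fin (m G) → ℤ
    ±d = signed o (toℤ ∘ d)
    pick≈ : ∀ e → toℤ (c e) + ±d e ≈ toℤ (pick o L₁ L₂ e)
    pick≈ e with o e
    ... | true  = c+d≈L₂ e
    ... | false = c-d≈L₁ e
    cancel : ∀ x y → x + (y - x) ≡ y
    cancel = solve-∀

lemma9 : (k : ℕ) → k ≥ 1 → (G : Digraph) →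
    ((f : Fin (m G) → Fin (suc (2 * k))) → (∀ e → ¬ (f e ≡ zero)) →
      (β : Fin (n G) → Fin (suc (2 * k))) → IsBoundary G (suc (2 * k)) β →
      Σ[ o ∈ Orientation G ] IsWeightedOrientation G (suc (2 * k)) f β o) →
    (L₁ L₂ : Fin (m G) → Fin (suc (2 * k))) → (∀ e → ¬ (L₁ e ≡ L₂ e)) →
    (β : Fin (n G) → Fin (suc (2 * k))) → IsBoundary G (suc (2 * k)) β →
    Σ[ g ∈ (Fin (m G) → Fin (suc (2 * k))) ]
      (IsFlow G (suc (2 * k)) g β × (∀ e → (g e ≡ L₁ e) ⊎ (g e ≡ L₂ e)))
lemma9 k _ G orientable L₁ L₂ L₁≢L₂ β β-boundary =
  let o , o-orients = orientable d (λ e → radius≢0 (L₁≢L₂ e)) (shiftBoundary β c)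
                                 (shiftBoundary-isBoundary c β-boundary)
  in pick o L₁ L₂
   , pick-isFlow c d L₁ L₂ (λ e → centre-radius≈ (L₁ e) (L₂ e)) (λ e → centre+radius≈ (L₁ e) (L₂ e))
                 o o-orients
   , pick-∈ o L₁ L₂
  where
  open Halving k
  open ListFlow G (suc (2 * k))
  c d : Fin (m G) → Fin (suc (2 * k))
  c e = centre (L₁ e) (L₂ e)
  d e = radius (L₁ e) (L₂ e)
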